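{- Let $r,s\ge 2$, let $P$ be a finite $(\mathbf{r}+\mathbf{s})$-free poset, let $C_1,\ldots,C_m$ be a First-Fit chain partition of $P$ with $C_j=\emptyset$ for $j>m$, and let $(S_0,F_0),\ldots,(S_n,F_n)$ be an evolution produced from the specific initial $2(s-1)$-society and replacement scheme described in the context. Then for each $i$ with $0\le i\le n$, $\bigcup_{X\in S_i}X\supseteq\bigcup_{j>i}C_j$.
   Context: $\mathbf{r}$ is a chain of $r$ elements; $P$ is $(\mathbf{r}+\mathbf{s})$-free if it contains no chains $A,B$ of sizes $r,s$ with every element of $A$ incomparable to every element of $B$. A First-Fit chain partition of $P$ is an ordered partition $C_1,\ldots,C_m$ of $P$ into non-empty chains such that whenever $i<j$ and $x\in C_j$, some element of $C_i$ is incomparable to $x$. Initial society: let $q$ be the height of $P$ and $h(x)$ the size of a largest chain with maximum element $x$. Let $Z(x)$ be the set of $z$ such that $P$ has a chain of size $r$ with minimum $x$ and maximum $z$; let $b(x)=\min\{h(z):z\in Z(x)\}$ if $Z(x)\ne\emptyset$ and $b(x)=q+1$ otherwise; let $I(x)=\{h(x),\ldots,b(x)-1\}$. For $1\le k\le q$ let $X_k=\{x\in P: k\in I(x)\}$ (a group, i.e. subset of $P$). Let $t=2(s-1)$ and $\varepsilon=1/(2t)$. $S_0$ is the list $X_1,\ldots,X_q$; every $S_j$ is a sublist of $S_0$ with the inherited order, and $\mathrm{dist}_j(Y,Z)$ is the absolute difference of the positions of $Y$ and $Z$ in the list $S_j$. A $t$-society is a pair $(S,F)$ with $S$ a list of groups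 and $F:S\times\{1,\ldots,t\}\to S\cup\{\star\}$; $Y$ lists $Z$ as a friend if $F(Y,k)=Z$ for some $k$. $F_0$ is chosen so that each $Y\in S_0$ lists, each in one slot, exactly the groups $Z\neq Y$ in $S_0$ with $\mathrm{dist}_0(Y,Z)\le s-1$, unused slots being $\star$. Transitions: for $1\le j\le n$, $S_j$ consists of those $X\in S_{j-1}$ satisfying one of, with type the first that applies: ($\alpha$) $X\cap C_j\ne\emptyset$; ($\beta$) otherwise some friend of $X$ in $(S_{j-1},F_{j-1})$ meets $C_j$; ($\gamma$) otherwise there is $0\le i\le j-1$ with $N^\alpha_{i,j-1}(X)>\varepsilon(j-i)$, where $N^a_{i,j}(X)$ is the number of $l$ with $i<l\le j$, $X\in S_l$, such that $X$ makes a type-$a$ transition from $S_{l-1}$ to $S_l$. Replacement scheme: if $F_{j-1}(Y,k)=Z$ and $Y,Z\in S_j$ then $F_j(Y,k)=Z$; the groups $Z\in S_j$ with $\mathrm{dist}_{j-1}(Y,Z)>s-1$ and $\mathrm{dist}_j(Y,Z)\le s-1$ are placed arbitrarily into the slots of $Y$ whose previous friend did not survive to $S_j$, and remaining such slots get $\star$; thus in $(S_j,F_j)$ each $Y$ lists exactly the other groups $Z$ with $\mathrm{dist}_j(Y,Z)\le s-1$. The evolution ends at the index $n$ with $S_n=\emptyset$. -}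

module Defs where

open import Data.Nat using (ℕ; zero; suc; _+_; _*_; _∸_; _≤_; _<_; _≤ᵇ_; _<ᵇ_; _≡ᵇ_; ∣_-_∣)
open import Data.Fin using (Fin; toℕ)
open import Data.Bool using (Bool; true; false; _∧_; if_then_else_)
open import Data.Maybe using (Maybe; just; nothing)
open import Data.List using (List; allFin; map)
open import Data.Nat.ListAction using (sum)
open import Data.Bool.ListAction using (any)
open import Data.Product using (Σ; ∃; _×_; _,_)
open import Data.Sum using (_⊎_)
open import Relation.Nullary using (¬_)
open import Relation.Binary.PropositionalEquality using (_≡_; _≢_)

module _ {N : ℕ} (_≼_ : Fin N → Fin N → Set) where

  Incomp : Fin N → Fin N → Set
  Incomp x y = ¬ (x ≼ y) × ¬ (y ≼ x)

  _≺_ : Fin N → Fin N → Set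
  x ≺ y = (x ≼ y) × (x ≢ y)

  IsChain : {k : ℕ} → (Fin k → Fin N) → Set
  IsChain v = ∀ i j → toℕ i < toℕ j → v i ≺ v j

  HasChain : ℕ → Set
  HasChain k = Σ (Fin k → Fin N) IsChain

  IsHeight : ℕ → Set
  IsHeight q = HasChain q × (∀ k → HasChain k → k ≤ q)

  ChainWithMax : Fin N → ℕ → Set
  ChainWithMax x k = Σ (Fin k → Fin N) λ v →
    IsChain v × (∃ λ i → v i ≡ x) × (∀ i → v i ≼ x)

  IsHFun : (Fin N → ℕ) → Set
  IsHFun h = ∀ x → ChainWithMax x (h x) × (∀ k → ChainWithMax x k → k ≤ h x)

  InZ : ℕ → Fin N → Fin N → Set
  InZ r x z = Σ (Fin r → Fin N) λ v →
    IsChain v × (∃ λ i → v i ≡ x) × (∃ λ i → v i ≡ z) × (∀ i → (x ≼ v i) × (v i ≼ z))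

  IsBFun : ℕ → ℕ → (Fin N → ℕ) → (Fin N → ℕ) → Set
  IsBFun r q h b = ∀ x →
      (Σ (Fin N) λ z → InZ r x z × h z ≡ b x × (∀ z′ → InZ r x z′ → b x ≤ h z′))
    ⊎ ((∀ z → ¬ InZ r x z) × b x ≡ suc q)

  RSFree : ℕ → ℕ → Set
  RSFree r s = (A : Fin r → Fin N) (B : Fin s → Fin N) →
    IsChain A → IsChain B → ¬ (∀ i j → Incomp (A i) (B j))

  -- First-Fit chain partition C_1,…,C_m, encoded by the label c : P → ℕ,
  -- C_j = { x | c x ≡ j }  (so C_j = ∅ automatically for j > m or j = 0).
  IsFirstFit : ℕ → (Fin N → ℕ) → Set
  IsFirstFit m c =
      (∀ x → (1 ≤ c x) × (c x ≤ m))
    × (∀ j → 1 ≤ j → j ≤ m → ∃ λ x → c x ≡ j)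
    × (∀ x y → c x ≡ c y → (x ≼ y) ⊎ (y ≼ x))
    × (∀ x i → 1 ≤ i → i < c x → ∃ λ y → (c y ≡ i) × Incomp x y)

-- Groups X_1,…,X_q are indexed by g : Fin q, with X_k for k = toℕ g + 1.
-- Lists S_j (sublists of S_0 with inherited order) are subsets S : Fin q → Bool.

module _ {N : ℕ} where

  inX : (h b : Fin N → ℕ) {q : ℕ} → Fin N → Fin q → Bool
  inX h b x g = (h x ≤ᵇ suc (toℕ g)) ∧ (suc (toℕ g) <ᵇ b x)

  meets : (h b c : Fin N → ℕ) {q : ℕ} → Fin q → ℕ → Bool
  meets h b c g j = any (λ x → (c x ≡ᵇ j) ∧ inX h b x g) (allFin N)

count : {q : ℕ} → (Fin q → Bool) → ℕ
count {q} f = sum (map (λ g → if f g then 1 else 0) (allFin q))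

rank : {q : ℕ} → (Fin q → Bool) → Fin q → ℕ
rank S g = count (λ g′ → S g′ ∧ (toℕ g′ <ᵇ toℕ g))

dist : {q : ℕ} → (Fin q → Bool) → Fin q → Fin q → ℕ
dist S Y Z = ∣ rank S Y - rank S Z ∣

-- N^α_{i,j}(X): number of l with i < l ≤ j, X ∈ S_l, X ∩ C_l ≠ ∅
-- (X ∈ S_l with X ∩ C_l ≠ ∅ is exactly a type-α transition at step l).
Nα : {N q : ℕ} (h b c : Fin N → ℕ) (S : ℕ → Fin q → Bool) →
     ℕ → ℕ → Fin q → ℕ
Nα h b c S i zero X = 0
Nα h b c S i (suc j) X =
  Nα h b c S i j X + (if (i <ᵇ suc j) ∧ S (suc j) X ∧ meets h b c X (suc j) then 1 else 0)

-- Evolutions of t-societies (t = 2(s-1)), S_j : Fin q → Bool,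
-- F_j : Fin q → Fin t → Maybe (Fin q)  (nothing = ⋆).

module _ {N q t : ℕ} (s : ℕ) (h b c : Fin N → ℕ)
         (S : ℕ → Fin q → Bool) (F : ℕ → Fin q → Fin t → Maybe (Fin q)) where

  TypeA : ℕ → Fin q → Set
  TypeA j′ X = meets h b c X (suc j′) ≡ true

  TypeB : ℕ → Fin q → Set
  TypeB j′ X = ∃ λ k → ∃ λ Z → (F j′ X k ≡ just Z) × (meets h b c Z (suc j′) ≡ true)

  -- N^α_{i,j′}(X) > ε (j′+1 − i) with ε = 1/(2t), i.e. j′+1−i < 2t·N^α
  TypeC : ℕ → Fin q → Set
  TypeC j′ X = ∃ λ i → (i ≤ j′) × (suc j′ ∸ i < 2 * t * Nα h b c S i j′ X)

  Transition : ℕ → Set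
  Transition j′ = ∀ X →
    (S (suc j′) X ≡ true → (S j′ X ≡ true) × (TypeA j′ X ⊎ TypeB j′ X ⊎ TypeC j′ X))
    × ((S j′ X ≡ true) × (TypeA j′ X ⊎ TypeB j′ X ⊎ TypeC j′ X) → S (suc j′) X ≡ true)

  InitialFriends : Set
  InitialFriends = ∀ Y →
      (∀ k Z → F 0 Y k ≡ just Z → (Z ≢ Y) × (dist (S 0) Y Z ≤ s ∸ 1))
    × (∀ Z → Z ≢ Y → dist (S 0) Y Z ≤ s ∸ 1 → ∃ λ k → F 0 Y k ≡ just Z)
    × (∀ k k′ Z → F 0 Y k ≡ just Z → F 0 Y k′ ≡ just Z → k ≡ k′)

  NewFriend : ℕ → Fin q → Fin q → Set
  NewFriend j′ Y Z = (S (suc j′) Z ≡ true) × (s ∸ 1 < dist (S j′) Y Z)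
                   × (dist (S (suc j′)) Y Z ≤ s ∸ 1)

  FreeSlot : ℕ → Fin q → Fin t → Set
  FreeSlot j′ Y k = ∀ Z → F j′ Y k ≡ just Z → S (suc j′) Z ≡ false

  Replacement : ℕ → Set
  Replacement j′ = ∀ Y → S (suc j′) Y ≡ true →
      (∀ k Z → F j′ Y k ≡ just Z → S (suc j′) Z ≡ true → F (suc j′) Y k ≡ just Z)
    × (∀ k Z → F (suc j′) Y k ≡ just Z →
          ((F j′ Y k ≡ just Z) × (S (suc j′) Z ≡ true))
        ⊎ (FreeSlot j′ Y k × NewFriend j′ Y Z))
    × (∀ Z → NewFriend j′ Y Z → ∃ λ k → F (suc j′) Y k ≡ just Z)
    × (∀ Z k k′ → NewFriend j′ Y Z → F (suc j′) Y k ≡ just Z →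
          F (suc j′) Y k′ ≡ just Z → k ≡ k′)

  IsEvolution : ℕ → Set
  IsEvolution n =
      (∀ X → S 0 X ≡ true)
    × InitialFriends
    × (∀ j′ → suc j′ ≤ n → Transition j′ × Replacement j′)
    × (∀ X → S n X ≡ false)

-- S₀ contains every group, and x lies in X_{h(x)} because h(x) < b(x).
-- For the step, First-Fit gives, for x ∈ C_j with j > i+1, some y ∈ C_{i+1} incomparable
-- to x. Then h(y) ≤ b(x) + s − 2, since otherwise the top s elements of a longest chain
-- ending at y have height at least b(x) and are incomparable to an r-chain from x to some z
-- with h(z) = b(x). The groups containing an element have consecutive indices, so groups of
-- S_i containing x and y can be moved towards each other until no group of S_i strictly
-- between them contains x or y; all groups in between then have index in [b(x), h(y)), so
-- the two groups coincide or lie at distance at most s − 1 in S_i, i.e. they are friends.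
-- Hence the group of x meets C_{i+1} itself or through a friend, and survives to S_{i+1}.

module Submission where

open import Defs
open import Data.Nat
  using (ℕ; zero; suc; _+_; _*_; _∸_; _≤_; _<_; _≤ᵇ_; _<ᵇ_; _≡ᵇ_; z≤n; s≤s; s≤s⁻¹; _≤?_; _<?_)
open import Data.Nat.Properties
open import Algebra.Properties.CommutativeSemigroup +-commutativeSemigroup using (interchange)
open import Data.Fin as Fin using (Fin; toℕ; fromℕ; fromℕ<; lower₁)
open import Data.Fin.Properties
  using (toℕ-injective; toℕ<n; toℕ-fromℕ; toℕ-fromℕ<; toℕ-lower₁; any?) renaming (_≟_ to _≟ᶠ_)
open import Data.Bool using (Bool; true; false; _∧_; _∨_; if_then_else_; T)
open import Data.Bool.Properties using (T-≡) renaming (_≟_ to _≟ᴮ_)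
open import Data.Maybe using (Maybe; just)
open import Data.List.Properties using (map-tabulate)
open import Data.List.Membership.Propositional using (lose)
open import Data.List.Membership.Propositional.Properties using (∈-allFin)
open import Data.List.Relation.Unary.Any.Properties using (any⁺)
open import Data.Nat.ListAction using (sum)
open import Data.Product using (Σ; ∃; _×_; _,_; proj₁; proj₂; swap)
open import Data.Sum using (_⊎_; inj₁; inj₂)
open import Data.Empty using (⊥-elim)
open import Function using (_∘_; id)
open import Function.Bundles using (Equivalence)
open import Relation.Nullary using (¬_; yes; no)
open import Relation.Nullary.Decidable using (_×-dec_; _⊎-dec_)
open import Relation.Binary using (tri<; tri≈; tri>)
open import Relation.Binary.PropositionalEquality
open import Relation.Binary.Structures using (IsPartialOrder)
open import Relation.Binary.Definitions using (Decidable)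

∧-true⁻ : ∀ a {b} → a ∧ b ≡ true → (a ≡ true) × (b ≡ true)
∧-true⁻ true b≡true = refl , b≡true

∧-true⁺ : ∀ {a b} → a ≡ true → b ≡ true → a ∧ b ≡ true
∧-true⁺ refl b≡true = b≡true

∨-true⁻ : ∀ a {b} → a ∨ b ≡ true → (a ≡ true) ⊎ (b ≡ true)
∨-true⁻ true _ = inj₁ refl
∨-true⁻ false b≡true = inj₂ b≡true

∨-true⁺ : ∀ {a b} → (a ≡ true) ⊎ (b ≡ true) → a ∨ b ≡ true
∨-true⁺ (inj₁ refl) = refl
∨-true⁺ {true} (inj₂ _) = refl
∨-true⁺ {false} (inj₂ b≡true) = b≡true

true⇒T : ∀ {b} → b ≡ true → T b
true⇒T = Equivalence.from T-≡

T⇒true : ∀ {b} → T b → b ≡ true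
T⇒true = Equivalence.to T-≡

indicator : Bool → ℕ
indicator b = if b then 1 else 0

indicator-mono : ∀ {a b} → (a ≡ true → b ≡ true) → indicator a ≤ indicator b
indicator-mono {false} _ = z≤n
indicator-mono {true} a⇒b rewrite a⇒b refl = ≤-refl

indicator-∪ : ∀ {a b c} → (a ≡ true → (b ≡ true) ⊎ (c ≡ true)) →
  indicator a ≤ indicator b + indicator c
indicator-∪ {false} _ = z≤n
indicator-∪ {true} {b} a⇒b∪c with a⇒b∪c refl
... | inj₁ refl = s≤s z≤n
... | inj₂ refl = m≤n+m 1 (indicator b)

count-suc : ∀ {q} (f : Fin (suc q) → Bool) →
  count f ≡ indicator (f Fin.zero) + count (f ∘ Fin.suc)
count-suc f = cong (λ l → indicator (f Fin.zero) + sum l)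
  (trans (map-tabulate Fin.suc (indicator ∘ f))
         (sym (map-tabulate id (indicator ∘ f ∘ Fin.suc))))

count-mono : ∀ {q} (f g : Fin q → Bool) → (∀ i → f i ≡ true → g i ≡ true) →
  count f ≤ count g
count-mono {zero} _ _ _ = z≤n
count-mono {suc q} f g f⊆g rewrite count-suc f | count-suc g =
  +-mono-≤ (indicator-mono (f⊆g Fin.zero))
           (count-mono (f ∘ Fin.suc) (g ∘ Fin.suc) (f⊆g ∘ Fin.suc))

count-∪ : ∀ {q} (f g k : Fin q → Bool) →
  (∀ i → f i ≡ true → (g i ≡ true) ⊎ (k i ≡ true)) → count f ≤ count g + count k
count-∪ {zero} _ _ _ _ = z≤n
count-∪ {suc q} f g k f⊆g∪k rewrite count-suc f | count-suc g | count-suc k =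
  ≤-trans (+-mono-≤ (indicator-∪ (f⊆g∪k Fin.zero))
                    (count-∪ (f ∘ Fin.suc) (g ∘ Fin.suc) (k ∘ Fin.suc) (f⊆g∪k ∘ Fin.suc)))
          (≤-reflexive (interchange (indicator (g Fin.zero)) (indicator (k Fin.zero)) _ _))

count-none : ∀ {q} (f : Fin q → Bool) → (∀ i → f i ≢ true) → count f ≡ 0
count-none {zero} _ _ = refl
count-none {suc q} f none rewrite count-suc f with f Fin.zero in f0
... | true = ⊥-elim (none Fin.zero f0)
... | false = count-none (f ∘ Fin.suc) (none ∘ Fin.suc)

AtIndex : ∀ {q} → ℕ → Fin q → Bool
AtIndex k g = toℕ g ≡ᵇ k

atIndex⁺ : ∀ {q} (g : Fin q) {k} → toℕ g ≡ k → AtIndex k g ≡ true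
atIndex⁺ _ g≡k = T⇒true (≡⇒≡ᵇ _ _ g≡k)

count-atIndex : ∀ {q} k → count {q} (AtIndex k) ≤ 1
count-atIndex {zero} _ = z≤n
count-atIndex {suc q} zero rewrite count-suc {q} (AtIndex 0)
  | count-none {q} (AtIndex 0 ∘ Fin.suc) (λ _ ()) = ≤-refl
count-atIndex {suc q} (suc k) rewrite count-suc {q} (AtIndex (suc k)) = count-atIndex {q} k

InInterval : ∀ {q} → ℕ → ℕ → Fin q → Bool
InInterval L U g = (L ≤ᵇ toℕ g) ∧ (toℕ g <ᵇ U)

inInterval⁻ : ∀ {q} L U (g : Fin q) → InInterval L U g ≡ true → (L ≤ toℕ g) × (toℕ g < U)
inInterval⁻ L U g e with ∧-true⁻ (L ≤ᵇ toℕ g) e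
... | L≤g , g<U = ≤ᵇ⇒≤ L (toℕ g) (true⇒T L≤g) , <ᵇ⇒< (toℕ g) U (true⇒T g<U)

inInterval⁺ : ∀ {q} {L U} {g : Fin q} → L ≤ toℕ g → toℕ g < U → InInterval L U g ≡ true
inInterval⁺ L≤g g<U = ∧-true⁺ (T⇒true (≤⇒≤ᵇ L≤g)) (T⇒true (<⇒<ᵇ g<U))

count-interval : ∀ {q} L U → count {q} (InInterval L U) ≤ U ∸ L
count-interval {q} L zero = ≤-trans (≤-reflexive (count-none {q} (InInterval L 0) empty)) z≤n
  where
  empty : ∀ g → InInterval L 0 g ≢ true
  empty g e = n≮0 (proj₂ (inInterval⁻ L 0 g e))
count-interval {q} L (suc U) with L ≤? U
... | yes L≤U = begin
  count {q} (InInterval L (suc U))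
    ≤⟨ count-∪ _ (InInterval L U) (AtIndex U) split ⟩
  count {q} (InInterval L U) + count {q} (AtIndex U)
    ≤⟨ +-mono-≤ (count-interval {q} L U) (count-atIndex {q} U) ⟩
  (U ∸ L) + 1
    ≡⟨ +-comm (U ∸ L) 1 ⟩
  1 + (U ∸ L)
    ≡⟨ +-∸-assoc 1 L≤U ⟨
  suc U ∸ L
    ∎
  where
  open ≤-Reasoning
  split : ∀ (g : Fin q) → InInterval L (suc U) g ≡ true →
          (InInterval L U g ≡ true) ⊎ (AtIndex U g ≡ true)
  split g e with inInterval⁻ L (suc U) g e
  ... | L≤g , g<1+U with m≤n⇒m<n∨m≡n (s≤s⁻¹ g<1+U)
  ...   | inj₁ g<U = inj₁ (inInterval⁺ L≤g g<U)
  ...   | inj₂ g≡U = inj₂ (atIndex⁺ g g≡U)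
... | no L≰U = ≤-trans (≤-reflexive (count-none {q} (InInterval L (suc U)) empty)) z≤n
  where
  empty : ∀ g → InInterval L (suc U) g ≢ true
  empty g e = let (L≤g , g<1+U) = inInterval⁻ L (suc U) g e
              in L≰U (≤-trans L≤g (s≤s⁻¹ g<1+U))

Below : ∀ {q} → (Fin q → Bool) → ℕ → Fin q → Bool
Below S k g = S g ∧ (toℕ g <ᵇ k)

below⁻ : ∀ {q} (S : Fin q → Bool) {k} (g : Fin q) → Below S k g ≡ true →
  (S g ≡ true) × (toℕ g < k)
below⁻ S {k} g e with ∧-true⁻ (S g) e
... | g∈S , g<k = g∈S , <ᵇ⇒< (toℕ g) k (true⇒T g<k)

below⁺ : ∀ {q} (S : Fin q → Bool) {k} {g : Fin q} → S g ≡ true → toℕ g < k →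
  Below S k g ≡ true
below⁺ S g∈S g<k = ∧-true⁺ g∈S (T⇒true (<⇒<ᵇ g<k))

rank-mono : ∀ {q} (S : Fin q → Bool) {X Y : Fin q} → toℕ X ≤ toℕ Y → rank S X ≤ rank S Y
rank-mono S {X} {Y} X≤Y = count-mono (Below S (toℕ X)) (Below S (toℕ Y)) λ g e →
  let (g∈S , g<X) = below⁻ S g e in below⁺ S g∈S (<-≤-trans g<X X≤Y)

MembersBetweenIn : ∀ {q} → (Fin q → Bool) → Fin q → Fin q → ℕ → ℕ → Set
MembersBetweenIn S X Y L U =
  ∀ g → S g ≡ true → toℕ X < toℕ g → toℕ g < toℕ Y → (L ≤ toℕ g) × (toℕ g < U)

rank-gap : ∀ {q} (S : Fin q → Bool) {X Y : Fin q} (L U : ℕ) → MembersBetweenIn S X Y L U →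
  rank S Y ≤ rank S X + suc (U ∸ L)
rank-gap {q} S {X} {Y} L U between = begin
  rank S Y
    ≤⟨ count-∪ _ (Below S (toℕ X)) Rest split ⟩
  rank S X + count Rest
    ≤⟨ +-monoʳ-≤ (rank S X)
         (count-∪ Rest (AtIndex (toℕ X)) (InInterval L U) λ g → ∨-true⁻ (AtIndex (toℕ X) g)) ⟩
  rank S X + (count {q} (AtIndex (toℕ X)) + count {q} (InInterval L U))
    ≤⟨ +-monoʳ-≤ (rank S X) (+-mono-≤ (count-atIndex {q} (toℕ X)) (count-interval {q} L U)) ⟩
  rank S X + suc (U ∸ L)
    ∎
  where
  open ≤-Reasoning
  Rest : Fin q → Bool
  Rest g = AtIndex (toℕ X) g ∨ InInterval L U g
  split : ∀ g → Below S (toℕ Y) g ≡ true → (Below S (toℕ X) g ≡ true) ⊎ (Rest g ≡ true)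
  split g e with below⁻ S g e
  ... | g∈S , g<Y with <-cmp (toℕ g) (toℕ X)
  ...   | tri< g<X _ _ = inj₁ (below⁺ S g∈S g<X)
  ...   | tri≈ _ g≡X _ = inj₂ (∨-true⁺ (inj₁ (atIndex⁺ g g≡X)))
  ...   | tri> _ _ X<g = let (L≤g , g<U) = between g g∈S X<g g<Y in
                         inj₂ (∨-true⁺ (inj₂ (inInterval⁺ L≤g g<U)))

dist-gap : ∀ {q} (S : Fin q → Bool) {X Y : Fin q} (L U : ℕ) → toℕ X ≤ toℕ Y →
  MembersBetweenIn S X Y L U → dist S X Y ≤ suc (U ∸ L)
dist-gap S {X} {Y} L U X≤Y between =
  subst (_≤ suc (U ∸ L)) (sym (m≤n⇒∣m-n∣≡n∸m (rank-mono S X≤Y)))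
        (m≤n+o⇒m∸n≤o (rank S Y) (rank S X) (rank-gap S L U between))

module Heights {N : ℕ} (_≼_ : Fin N → Fin N → Set) (po : IsPartialOrder _≡_ _≼_)
                (h : Fin N → ℕ) (h-spec : IsHFun _≼_ h) where
  open IsPartialOrder po using (antisym) renaming (trans to ≼-trans; reflexive to ≼-reflexive)

  h-pos : ∀ x → 0 < h x
  h-pos x with proj₁ (h-spec x)
  ... | _ , _ , (i , _) , _ = ≤-<-trans z≤n (toℕ<n i)

  h≤height : ∀ {q} → IsHeight _≼_ q → ∀ x → h x ≤ q
  h≤height (_ , maximal) x with proj₁ (h-spec x)
  ... | v , v-chain , _ = maximal (h x) (v , v-chain)

  snoc : ∀ {k} → (Fin k → Fin N) → Fin N → Fin (suc k) → Fin N
  snoc {k} v w i with k ≟ toℕ i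
  ... | yes _ = w
  ... | no k≢i = v (lower₁ i k≢i)

  snoc-chain : ∀ {u w k} → ChainWithMax _≼_ u k → _≺_ _≼_ u w → ChainWithMax _≼_ w (suc k)
  snoc-chain {u} {w} {k} (v , v-chain , _ , v≼u) (u≼w , u≢w) =
    snoc v w , chain , (fromℕ k , snoc-last) , snoc-≼
    where
    below-w : ∀ j → _≺_ _≼_ (v j) w
    below-w j = ≼-trans (v≼u j) u≼w , λ vj≡w → u≢w (antisym u≼w (subst (_≼ u) vj≡w (v≼u j)))
    snoc-last : snoc v w (fromℕ k) ≡ w
    snoc-last with k ≟ toℕ (fromℕ k)
    ... | yes _ = refl
    ... | no k≢k = ⊥-elim (k≢k (sym (toℕ-fromℕ k)))
    snoc-≼ : ∀ i → snoc v w i ≼ w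
    snoc-≼ i with k ≟ toℕ i
    ... | yes _ = ≼-reflexive refl
    ... | no _ = proj₁ (below-w _)
    chain : IsChain _≼_ (snoc v w)
    chain i i′ i<i′ with k ≟ toℕ i | k ≟ toℕ i′
    ... | yes k≡i | _ = ⊥-elim (<⇒≱ i<i′ (subst (toℕ i′ ≤_) k≡i (s≤s⁻¹ (toℕ<n i′))))
    ... | no _ | yes _ = below-w _
    ... | no k≢i | no k≢i′ =
      v-chain _ _ (subst₂ _<_ (sym (toℕ-lower₁ i k≢i)) (sym (toℕ-lower₁ i′ k≢i′)) i<i′)

  h-strict : ∀ {u w} → _≺_ _≼_ u w → h u < h w
  h-strict {u} {w} u≺w = proj₂ (h-spec w) (suc (h u)) (snoc-chain (proj₁ (h-spec u)) u≺w)

  h-chain : ∀ {k} {v : Fin k → Fin N} → IsChain _≼_ v →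
    ∀ m (m<k : m < k) → m < h (v (fromℕ< m<k))
  h-chain _ zero _ = h-pos _
  h-chain v-chain (suc m) m+1<k =
    ≤-<-trans (h-chain v-chain m m<k) (h-strict (v-chain (fromℕ< m<k) (fromℕ< m+1<k) step))
    where
    m<k : m < _
    m<k = <-trans (n<1+n m) m+1<k
    step : toℕ (fromℕ< m<k) < toℕ (fromℕ< m+1<k)
    step = subst₂ _<_ (sym (toℕ-fromℕ< m<k)) (sym (toℕ-fromℕ< m+1<k)) (n<1+n m)

  top-chain : ∀ y k → k ≤ h y → Σ (Fin k → Fin N) λ B →
    IsChain _≼_ B × (∀ j → B j ≼ y) × (∀ j → h y < k + h (B j))
  top-chain y k k≤hy with proj₁ (h-spec y)
  ... | v , v-chain , _ , v≼y = B , B-chain , v≼y ∘ index , B-high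
    where
    e : ℕ
    e = h y ∸ k
    e+k≡hy : e + k ≡ h y
    e+k≡hy = m∸n+n≡m k≤hy
    index-< : (j : Fin k) → e + toℕ j < h y
    index-< j = subst (e + toℕ j <_) e+k≡hy (+-monoʳ-< e (toℕ<n j))
    index : Fin k → Fin (h y)
    index j = fromℕ< (index-< j)
    B : Fin k → Fin N
    B = v ∘ index
    B-chain : IsChain _≼_ B
    B-chain j j′ j<j′ = v-chain (index j) (index j′)
      (subst₂ _<_ (sym (toℕ-fromℕ< (index-< j))) (sym (toℕ-fromℕ< (index-< j′)))
              (+-monoʳ-< e j<j′))
    B-high : ∀ j → h y < k + h (B j)
    B-high j = begin-strict
      h y          ≡⟨ e+k≡hy ⟨
      e + k        ≡⟨ +-comm e k ⟩
      k + e        <⟨ +-monoʳ-< k (m+n≤o⇒m≤o (suc e) (h-chain v-chain (e + toℕ j) (index-< j))) ⟩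
      k + h (B j)  ∎
      where open ≤-Reasoning

inX⁻ : ∀ {N q} (h b : Fin N → ℕ) x (X : Fin q) → inX h b x X ≡ true →
  (h x ≤ suc (toℕ X)) × (suc (toℕ X) < b x)
inX⁻ h b x X e with ∧-true⁻ (h x ≤ᵇ suc (toℕ X)) e
... | low , high = ≤ᵇ⇒≤ _ _ (true⇒T low) , <ᵇ⇒< _ _ (true⇒T high)

inX⁺ : ∀ {N q} (h b : Fin N → ℕ) {x} {X : Fin q} → h x ≤ suc (toℕ X) → suc (toℕ X) < b x →
  inX h b x X ≡ true
inX⁺ h b low high = ∧-true⁺ (T⇒true (≤⇒≤ᵇ low)) (T⇒true (<⇒<ᵇ high))

inX-above : ∀ {N q} (h b : Fin N → ℕ) {x} {X : Fin q} → h x ≤ suc (toℕ X) →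
  inX h b x X ≢ true → b x ≤ suc (toℕ X)
inX-above h b {x} {X} low x∉X with b x ≤? suc (toℕ X)
... | yes above = above
... | no below = ⊥-elim (x∉X (inX⁺ h b low (≰⇒> below)))

inX-below : ∀ {N q} (h b : Fin N → ℕ) {x} {X : Fin q} → suc (toℕ X) < b x →
  inX h b x X ≢ true → suc (toℕ X) < h x
inX-below h b {x} {X} high x∉X with h x ≤? suc (toℕ X)
... | yes low = ⊥-elim (x∉X (inX⁺ h b low high))
... | no below = ≰⇒> below

InZ-≼ : ∀ {N} {_≼_ : Fin N → Fin N → Set} {r x z} → InZ _≼_ r x z → x ≼ z
InZ-≼ {_≼_ = _≼_} {x = x} (_ , _ , _ , (i , vi≡z) , between) =
  subst (x ≼_) vi≡z (proj₁ (between i))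

module Bounds {N : ℕ} (_≼_ : Fin N → Fin N → Set) (po : IsPartialOrder _≡_ _≼_)
              (h : Fin N → ℕ) (h-spec : IsHFun _≼_ h) {q : ℕ} (height : IsHeight _≼_ q)
              (r′ : ℕ) (b : Fin N → ℕ) (b-spec : IsBFun _≼_ (suc (suc r′)) q h b) where
  open IsPartialOrder po using (antisym) renaming (trans to ≼-trans)
  open Heights _≼_ po h h-spec

  h<b : ∀ x → h x < b x
  h<b x with b-spec x
  ... | inj₂ (_ , bx≡1+q) = subst (h x <_) (sym bx≡1+q) (s≤s (h≤height height x))
  ... | inj₁ (z , x-to-z@(A , A-chain , _ , _ , A-between) , hz≡bx , _) =
        subst (h x <_) hz≡bx (h-strict (InZ-≼ x-to-z , x≢z))
    where
    x≢z : x ≢ z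
    x≢z refl =
      proj₂ (A-chain Fin.zero (Fin.suc Fin.zero) (s≤s z≤n)) (trans (A≡x _) (sym (A≡x _)))
      where
      A≡x : ∀ j → A j ≡ x
      A≡x j = antisym (proj₂ (A-between j)) (proj₁ (A-between j))

  own-group : ∀ x → Σ (Fin q) λ X → inX h b x X ≡ true
  own-group x =
    X , inX⁺ h b (≤-reflexive (sym toℕX+1≡hx)) (subst (_< b x) (sym toℕX+1≡hx) (h<b x))
    where
    hx-1<q : h x ∸ 1 < q
    hx-1<q = <-≤-trans (∸-monoˡ-< (n<1+n (h x)) (h-pos x)) (h≤height height x)
    X : Fin q
    X = fromℕ< hx-1<q
    toℕX+1≡hx : suc (toℕ X) ≡ h x
    toℕX+1≡hx = trans (cong suc (toℕ-fromℕ< hx-1<q)) (m+[n∸m]≡n (h-pos x))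

  incomparable⇒h≤b+s′ : ∀ {s′} → RSFree _≼_ (suc (suc r′)) (suc (suc s′)) →
    ∀ {x y} → Incomp _≼_ x y → h y ≤ b x + s′
  incomparable⇒h≤b+s′ {s′} rs-free {x} {y} (x⋠y , _) with h y ≤? b x + s′
  ... | yes fits = fits
  ... | no too-high with b-spec x
  ...   | inj₂ (_ , bx≡1+q) =
          ⊥-elim (too-high (≤-trans (h≤height height y) (≤-trans (n≤1+n q)
                   (subst (_≤ b x + s′) bx≡1+q (m≤m+n (b x) s′)))))
  ...   | inj₁ (z , x-to-z@(A , A-chain , _ , _ , A-between) , hz≡bx , _)
          with top-chain y (suc (suc s′))
                 (≤-trans (s≤s (+-monoˡ-≤ s′ (subst (0 <_) hz≡bx (h-pos z)))) (≰⇒> too-high))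
  ...     | B , B-chain , B≼y , B-high =
          ⊥-elim (rs-free A B A-chain B-chain λ i j → A⋠B i j , B⋠A i j)
    where
    bx≤hB : ∀ j → b x ≤ h (B j)
    bx≤hB j = +-cancelˡ-≤ s′ _ _ (subst (_≤ s′ + h (B j)) (+-comm (b x) s′)
                (s≤s⁻¹ (s≤s⁻¹ (≤-trans (s≤s (≰⇒> too-high)) (B-high j)))))
    A⋠B : ∀ i j → ¬ (A i ≼ B j)
    A⋠B i j Ai≼Bj = x⋠y (≼-trans (proj₁ (A-between i)) (≼-trans Ai≼Bj (B≼y j)))
    B⋠A : ∀ i j → ¬ (B j ≼ A i)
    B⋠A i j Bj≼Ai with B j ≟ᶠ z
    ... | yes Bj≡z = x⋠y (≼-trans (InZ-≼ x-to-z) (subst (_≼ y) Bj≡z (B≼y j)))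
    ... | no Bj≢z = <⇒≱ (subst (h (B j) <_) hz≡bx Bj<z) (bx≤hB j)
      where
      Bj<z : h (B j) < h z
      Bj<z = h-strict (≼-trans Bj≼Ai (proj₂ (A-between i)) , Bj≢z)

m≤n+o⇒[m∸1]∸[n∸1]≤o : ∀ m n o → m ≤ n + o → (m ∸ 1) ∸ (n ∸ 1) ≤ o
m≤n+o⇒[m∸1]∸[n∸1]≤o m zero o m≤o = ≤-trans (m∸n≤m m 1) m≤o
m≤n+o⇒[m∸1]∸[n∸1]≤o m (suc n) o m≤1+n+o =
  subst (_≤ o) (sym (∸-+-assoc m 1 n)) (m≤n+o⇒m∸n≤o m (suc n) m≤1+n+o)

Covers : ∀ {N q} (h b : Fin N → ℕ) (S : Fin q → Bool) → Fin q → Fin N → Set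
Covers h b S X x = (S X ≡ true) × (inX h b x X ≡ true)

module Nearby {N q : ℕ} (h b : Fin N → ℕ) (S : Fin q → Bool) (d : ℕ) where

  NearbyCovers : Fin N → Fin N → Set
  NearbyCovers x y = Σ (Fin q) λ X → Σ (Fin q) λ Y →
    Covers h b S X x × Covers h b S Y y × ((X ≡ Y) ⊎ (dist S X Y ≤ suc d))

  nearby-sym : ∀ {x y} → NearbyCovers x y → NearbyCovers y x
  nearby-sym (X , Y , cX , cY , inj₁ X≡Y) = Y , X , cY , cX , inj₁ (sym X≡Y)
  nearby-sym (X , Y , cX , cY , inj₂ near) =
    Y , X , cY , cX , inj₂ (subst (_≤ suc d) (∣-∣-comm (rank S X) (rank S Y)) near)

  module _ {x y : Fin N} (hy≤bx+d : h y ≤ b x + d) where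

    Between : Fin q → Fin q → Fin q → Set
    Between X Y g = (S g ≡ true) × (toℕ X < toℕ g) × (toℕ g < toℕ Y)
                  × ((inX h b x g ≡ true) ⊎ (inX h b y g ≡ true))

    no-between⇒near : ∀ {X Y} → Covers h b S X x → Covers h b S Y y → toℕ X ≤ toℕ Y →
      (∀ g → ¬ Between X Y g) → dist S X Y ≤ suc d
    no-between⇒near {X} {Y} (_ , x∈X) (_ , y∈Y) X≤Y none =
      ≤-trans (dist-gap S (b x ∸ 1) (h y ∸ 1) X≤Y gap-window)
              (s≤s (m≤n+o⇒[m∸1]∸[n∸1]≤o (h y) (b x) d hy≤bx+d))
      where
      gap-window : MembersBetweenIn S X Y (b x ∸ 1) (h y ∸ 1)
      gap-window g g∈S X<g g<Y =
          ∸-monoˡ-≤ 1 (inX-above h b (≤-trans (proj₁ (inX⁻ h b x X x∈X)) (<⇒≤ (s≤s X<g)))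
                                     λ x∈g → none g (g∈S , X<g , g<Y , inj₁ x∈g))
        , ∸-monoˡ-≤ 1 (inX-below h b (<-trans (s≤s g<Y) (proj₂ (inX⁻ h b y Y y∈Y)))
                                     λ y∈g → none g (g∈S , X<g , g<Y , inj₂ y∈g))

    shrink : ∀ fuel {X Y} → Covers h b S X x → Covers h b S Y y → toℕ X ≤ toℕ Y →
      toℕ Y ∸ toℕ X ≤ fuel → NearbyCovers x y
    shrink zero {X} {Y} cX cY X≤Y gap =
      X , Y , cX , cY , inj₁ (toℕ-injective (≤-antisym X≤Y (m∸n≡0⇒m≤n (n≤0⇒n≡0 gap))))
    shrink (suc fuel) {X} {Y} cX cY X≤Y gap with any? (λ g →
      (S g ≟ᴮ true) ×-dec (toℕ X <? toℕ g) ×-dec (toℕ g <? toℕ Y)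
      ×-dec ((inX h b x g ≟ᴮ true) ⊎-dec (inX h b y g ≟ᴮ true)))
    ... | no none =
      X , Y , cX , cY , inj₂ (no-between⇒near cX cY X≤Y λ g between → none (g , between))
    ... | yes (g , g∈S , X<g , g<Y , inj₁ x∈g) =
      shrink fuel (g∈S , x∈g) cY (<⇒≤ g<Y) (s≤s⁻¹ (≤-trans (∸-monoʳ-< X<g (<⇒≤ g<Y)) gap))
    ... | yes (g , g∈S , X<g , g<Y , inj₂ y∈g) =
      shrink fuel cX (g∈S , y∈g) (<⇒≤ X<g) (s≤s⁻¹ (≤-trans (∸-monoˡ-< g<Y (<⇒≤ X<g)) gap))

  nearby-covers : ∀ {x y X Y} → h y ≤ b x + d → h x ≤ b y + d →
    Covers h b S X x → Covers h b S Y y → NearbyCovers x y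
  nearby-covers {X = X} {Y} hy≤bx+d hx≤by+d cX cY with toℕ X ≤? toℕ Y
  ... | yes X≤Y = shrink hy≤bx+d _ cX cY X≤Y ≤-refl
  ... | no X≰Y = nearby-sym (shrink hx≤by+d _ cY cX (<⇒≤ (≰⇒> X≰Y)) ≤-refl)

meets⁺ : ∀ {N q} (h b c : Fin N → ℕ) {y j} {Y : Fin q} → c y ≡ j → inX h b y Y ≡ true →
  meets h b c Y j ≡ true
meets⁺ h b c {y} cy≡j y∈Y =
  T⇒true (any⁺ _ (lose (∈-allFin y) (true⇒T (∧-true⁺ (T⇒true (≡⇒≡ᵇ _ _ cy≡j)) y∈Y))))

module Evolution {N q t : ℕ} (s : ℕ) (h b c : Fin N → ℕ) (S : ℕ → Fin q → Bool)
                 (F : ℕ → Fin q → Fin t → Maybe (Fin q)) {n : ℕ}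
                 (evolution : IsEvolution s h b c S F n) where

  step : ∀ j → suc j ≤ n → Transition s h b c S F j × Replacement s h b c S F j
  step = proj₁ (proj₂ (proj₂ evolution))

  was-present : ∀ {j X} → suc j ≤ n → S (suc j) X ≡ true → S j X ≡ true
  was-present {j} {X} j<n X∈ = proj₁ (proj₁ (proj₁ (step j j<n) X) X∈)

  friends-complete : ∀ j → j ≤ n → ∀ {Y Z} → S j Y ≡ true → S j Z ≡ true → Z ≢ Y →
    dist (S j) Y Z ≤ s ∸ 1 → ∃ λ k → F j Y k ≡ just Z
  friends-complete zero _ {Y} {Z} _ _ Z≢Y near =
    proj₁ (proj₂ (proj₁ (proj₂ evolution) Y)) Z Z≢Y near
  friends-complete (suc j) j<n {Y} {Z} Y∈ Z∈ Z≢Y near with proj₂ (step j j<n) Y Y∈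
  ... | kept , _ , new , _ with dist (S j) Y Z ≤? s ∸ 1
  ...   | yes was-near =
    let (k , FjYk≡Z) =
          friends-complete j (<⇒≤ j<n) (was-present j<n Y∈) (was-present j<n Z∈) Z≢Y was-near
    in k , kept k Z FjYk≡Z Z∈
  ...   | no was-far = new Z (Z∈ , ≰⇒> was-far , near)

  survives : ∀ j → suc j ≤ n → ∀ {X Y} → S j X ≡ true → S j Y ≡ true →
    (X ≡ Y) ⊎ (dist (S j) X Y ≤ s ∸ 1) → meets h b c Y (suc j) ≡ true → S (suc j) X ≡ true
  survives j j<n {X} {Y} X∈ Y∈ X-near-Y Y-meets =
    proj₂ (proj₁ (step j j<n) X) (X∈ , transition X-near-Y)
    where
    transition : (X ≡ Y) ⊎ (dist (S j) X Y ≤ s ∸ 1) →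
      TypeA s h b c S F j X ⊎ TypeB s h b c S F j X ⊎ TypeC s h b c S F j X
    transition (inj₁ refl) = inj₁ Y-meets
    transition (inj₂ near) with X ≟ᶠ Y
    ... | yes refl = inj₁ Y-meets
    ... | no X≢Y = let (k , FjXk≡Y) = friends-complete j (<⇒≤ j<n) X∈ Y∈ (X≢Y ∘ sym) near
                   in inj₂ (inj₁ (k , Y , FjXk≡Y , Y-meets))

lemma6 : (r s : ℕ) → 2 ≤ r → 2 ≤ s →
    (N : ℕ) (_≼_ : Fin N → Fin N → Set) → IsPartialOrder _≡_ _≼_ → Decidable _≼_ →
    RSFree _≼_ r s →
    (m : ℕ) (c : Fin N → ℕ) → IsFirstFit _≼_ m c →
    (q : ℕ) → IsHeight _≼_ q →
    (h : Fin N → ℕ) → IsHFun _≼_ h →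
    (b : Fin N → ℕ) → IsBFun _≼_ r q h b →
    (S : ℕ → Fin q → Bool) (F : ℕ → Fin q → Fin (2 * (s ∸ 1)) → Maybe (Fin q)) (n : ℕ) →
    IsEvolution s h b c S F n →
    ∀ i → i ≤ n → ∀ x → i < c x →
      Σ (Fin q) λ X → (S i X ≡ true) × (inX h b x X ≡ true)
lemma6 (suc (suc r′)) (suc (suc s′)) (s≤s (s≤s z≤n)) (s≤s (s≤s z≤n)) _ _≼_ po _ rs-free
       _ c first-fit q height h h-spec b b-spec S F n evolution = covered
  where
  open Bounds _≼_ po h h-spec height r′ b b-spec
  open Evolution (suc (suc s′)) h b c S F evolution
  open Nearby h b

  covered : ∀ i → i ≤ n → ∀ x → i < c x → Σ (Fin q) λ X → Covers h b (S i) X x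
  covered zero _ x _ = let (X , x∈X) = own-group x in X , proj₁ evolution X , x∈X
  covered (suc i) i<n x 1+i<cx =
    let (y , cy≡1+i , x∥y) = proj₂ (proj₂ (proj₂ first-fit)) x (suc i) (s≤s z≤n) 1+i<cx
        (X , Y , (X∈ , x∈X) , (Y∈ , y∈Y) , X-near-Y) = nearby-covers (S i) s′
            (incomparable⇒h≤b+s′ rs-free x∥y) (incomparable⇒h≤b+s′ rs-free (swap x∥y))
            (proj₂ (covered i (<⇒≤ i<n) x (<-trans (n<1+n i) 1+i<cx)))
            (proj₂ (covered i (<⇒≤ i<n) y (subst (i <_) (sym cy≡1+i) (n<1+n i))))
    in X , survives i i<n X∈ Y∈ X-near-Y (meets⁺ h b c cy≡1+i y∈Y) , x∈X
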